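{- Let $G$ be a finite simple graph, $G^2$ the disjoint union of two copies of $G$, and $n\ge 2|V(G)|$. Then $p(G^2)=\bar r(G^2)$, where both are computed with respect to $K_n$.
   Context: $K_n$ is the complete graph on $[n]$ without loops; a homomorphism $f:G\to K_n$ is a map $V(G)\to[n]$ sending adjacent vertices to distinct vertices. An edge $xy$ of $K_n$ is $f$-odd if the number of edges $uv\in E(G)$ with $\{f(u),f(v)\}=\{x,y\}$ is odd; $f$ is even if no edge is $f$-odd. A vertex of $K_n$ is $f$-odd if incident with an $f$-odd edge; $V_{\mathrm{odd}}(f)$ is the set of $f$-odd vertices. Define $r(f)=|V(G)|-|f(V(G))|+\frac12|V_{\mathrm{odd}}(f)|$, $\bar r(G)=\min\{r(f): f:G\to K_n\text{ a homomorphism}\}$, and $p(G)=\min\{|V(G)|-|f(V(G))|: f:G\to K_n \text{ an even homomorphism}\}$. -}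

module Defs where

open import Data.Nat using (ℕ; zero; suc; _+_; _*_; _∸_; _≤_; _<ᵇ_; _≡ᵇ_; _%_)
open import Data.Fin using (Fin; zero; suc; toℕ; splitAt)
open import Data.Fin.Properties using (_≟_)
open import Data.Bool using (Bool; true; false; _∧_; _∨_; not; if_then_else_)
open import Data.Sum using (inj₁; inj₂)
open import Data.Product using (Σ; _×_; _,_)
open import Relation.Nullary using (¬_; does)
open import Relation.Binary.PropositionalEquality using (_≡_; _≢_)

record SimpleGraph (m : ℕ) : Set where
  field
    adj   : Fin m → Fin m → Bool
    sym   : ∀ u v → adj u v ≡ adj v u
    loopless : ∀ u → adj u u ≡ false
open SimpleGraph public

countF : ∀ {k} → (Fin k → Bool) → ℕ
countF {zero}  p = 0
countF {suc k} p = (if p zero then 1 else 0) + countF (λ i → p (suc i))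

anyF : ∀ {k} → (Fin k → Bool) → Bool
anyF {zero}  p = false
anyF {suc k} p = p zero ∨ anyF (λ i → p (suc i))

_==_ : ∀ {k} → Fin k → Fin k → Bool
x == y = does (x ≟ y)

_⊕_ : ∀ {m k} → SimpleGraph m → SimpleGraph k → SimpleGraph (m + k)
_⊕_ {m} {k} G H = record { adj = a ; sym = s ; loopless = l }
  where
  a : Fin (m + k) → Fin (m + k) → Bool
  a u v with splitAt m u | splitAt m v
  ... | inj₁ i | inj₁ j = adj G i j
  ... | inj₂ i | inj₂ j = adj H i j
  ... | inj₁ _ | inj₂ _ = false
  ... | inj₂ _ | inj₁ _ = false
  s : ∀ u v → a u v ≡ a v u
  s u v with splitAt m u | splitAt m v
  ... | inj₁ i | inj₁ j = sym G i j
  ... | inj₂ i | inj₂ j = sym H i j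
  ... | inj₁ _ | inj₂ _ = Relation.Binary.PropositionalEquality.refl
  ... | inj₂ _ | inj₁ _ = Relation.Binary.PropositionalEquality.refl
  l : ∀ u → a u u ≡ false
  l u with splitAt m u
  ... | inj₁ i = loopless G i
  ... | inj₂ i = loopless H i

square : ∀ {m} → SimpleGraph m → SimpleGraph (m + m)
square G = G ⊕ G

-- Homomorphisms G → K_n.
IsHom : ∀ {m} (G : SimpleGraph m) (n : ℕ) → (Fin m → Fin n) → Set
IsHom G n f = ∀ u v → adj G u v ≡ true → f u ≢ f v

sumF : ∀ {k} → (Fin k → ℕ) → ℕ
sumF {zero}  g = 0
sumF {suc k} g = g zero + sumF (λ i → g (suc i))

module _ {m n : ℕ} (G : SimpleGraph m) (f : Fin m → Fin n) where

  -- number of edges uv ∈ E(G) (each unordered edge counted once,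
  -- via toℕ u < toℕ v) with {f u, f v} = {x, y}
  edgeCount : Fin n → Fin n → ℕ
  edgeCount x y = sumF λ u → countF λ v →
    (toℕ u <ᵇ toℕ v) ∧ adj G u v ∧
    (((f u == x) ∧ (f v == y)) ∨ ((f u == y) ∧ (f v == x)))

  isOddEdge : Fin n → Fin n → Bool
  isOddEdge x y = not (x == y) ∧ (edgeCount x y % 2 ≡ᵇ 1)

  isOddVertex : Fin n → Bool
  isOddVertex x = anyF λ y → isOddEdge x y

  numOdd : ℕ
  numOdd = countF isOddVertex

  imageSize : ℕ
  imageSize = countF λ x → anyF λ u → f u == x

  defect : ℕ
  defect = m ∸ imageSize

  -- 2 r(f) = 2(|V(G)| - |f(V(G))|) + |V_odd(f)|   (r(f) may be a half-integer)
  twiceR : ℕ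
  twiceR = 2 * defect + numOdd

  IsEven : Set
  IsEven = ∀ x y → isOddEdge x y ≡ false

IsMinOver : ∀ {m n} → ((Fin m → Fin n) → Set) → ((Fin m → Fin n) → ℕ) → ℕ → Set
IsMinOver P val k =
  Σ _ (λ f → P f × val f ≡ k) × (∀ f → P f → k ≤ val f)

IsTwiceRbar : ∀ {m} (G : SimpleGraph m) (n : ℕ) → ℕ → Set
IsTwiceRbar G n k = IsMinOver (IsHom G n) (twiceR G) k

IsTwiceP : ∀ {m} (G : SimpleGraph m) (n : ℕ) → ℕ → Set
IsTwiceP G n k = IsMinOver (λ f → IsHom G n f × IsEven G f) (λ f → 2 * defect G f) k

module Submission where

-- For an even homomorphism r(f) = |V| - |f(V)|, so r̄ ≤ p is immediate.  The
-- content is the converse: every homomorphism f : G² → K_n is beaten by an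
-- even one.  Two facts give this.
--   (1) Splitting.  With f₁, f₂ the restrictions of f to the two copies of G,
--       r(f₁) + r(f₂) ≤ r(f)  (pointwise count over the vertices of K_n).
--   (2) Even doubling.  For a homomorphism h : G → K_n and n ≥ 2m there is an
--       even homomorphism g : G² → K_n with |V(G²)| - |g(V(G²))| ≤ 2 r(h):
--       relabel the values of h injectively into a first block of m colours
--       on the first copy; on the second copy reuse those colours at the
--       h-odd values and use fresh colours from a second block elsewhere.
--       Every edge of K_n then carries either twice an h-edge count or the
--       (even) count at an h-even vertex.
-- Applying (2) to the better of f₁, f₂ proves the claim; finiteness of the
-- set of maps Fin 2m → Fin n makes both minima exist.

open import Defs hiding (sym)
open import Algebra.Properties.CommutativeSemigroup using (interchange)
open import Data.Bool using (Bool; true; false; _∧_; _∨_; not; if_then_else_)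
open import Data.Bool.Properties using (∨-assoc; ∨-comm; ∧-zeroʳ; ∧-identityʳ)
  renaming (_≟_ to _≟𝔹_)
open import Data.Empty using (⊥-elim)
open import Data.Fin using (Fin; zero; suc; toℕ; _↑ˡ_; _↑ʳ_; splitAt; inject≤)
open import Data.Fin.Properties
  using (_≟_; any?; all?; toℕ-↑ˡ; toℕ-↑ʳ; toℕ-inject≤; splitAt-↑ˡ; splitAt-↑ʳ; toℕ<n;
         inject≤-injective; ↑ˡ-injective; ↑ʳ-injective)
open import Data.Nat using (ℕ; zero; suc; _+_; _*_; _∸_; _≤_; _<_; _<ᵇ_; _≡ᵇ_; _%_; z≤n; s≤s)
open import Data.Nat.DivMod using (m%n<n; %-distribˡ-+)
open import Data.Nat.Induction using (<-rec)
open import Data.Nat.Properties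
  using (+-comm; +-assoc; +-identityʳ; *-zeroʳ; +-mono-≤; +-monoˡ-≤; +-monoʳ-≤; *-monoʳ-≤; *-distribˡ-+;
         +-cancelʳ-≤; +-commutativeSemigroup; ≤-refl; ≤-reflexive; ≤-trans; ≤-total;
         m≤m+n; <⇒≢; ≮⇒≥; anyUpTo?; m∸n+n≡m; m≤n+m∸n; m≤n+o⇒m∸n≤o; module ≤-Reasoning)
  renaming (_≟_ to _≟ℕ_)
open import Data.Nat.Tactic.RingSolver using (solve-∀)
open import Data.Product using (Σ; ∃; _×_; _,_)
open import Data.Sum using (_⊎_; inj₁; inj₂)
open import Data.Vec.Functional using (_++_; take; drop; _∷_)
open import Data.Vec.Functional.Properties using (lookup-++ˡ; lookup-++ʳ)
open import Relation.Nullary using (Dec; yes; no)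
open import Relation.Nullary.Decidable using (_×-dec_; _→-dec_; ¬?)
open import Relation.Binary.PropositionalEquality
  using (_≡_; _≢_; refl; sym; trans; cong; cong₂; subst; _≗_; module ≡-Reasoning)

ind : Bool → ℕ
ind b = if b then 1 else 0

ind≤1 : ∀ b → ind b ≤ 1
ind≤1 true  = ≤-refl
ind≤1 false = z≤n

countF-sumF : ∀ {k} (p : Fin k → Bool) → countF p ≡ sumF (λ i → ind (p i))
countF-sumF {zero}  p = refl
countF-sumF {suc k} p = cong (ind (p zero) +_) (countF-sumF (λ i → p (suc i)))

sumF-cong : ∀ {k} {f g : Fin k → ℕ} → f ≗ g → sumF f ≡ sumF g
sumF-cong {zero}  e = refl
sumF-cong {suc k} e = cong₂ _+_ (e zero) (sumF-cong (λ i → e (suc i)))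

sumF-mono : ∀ {k} {f g : Fin k → ℕ} → (∀ i → f i ≤ g i) → sumF f ≤ sumF g
sumF-mono {zero}  le = z≤n
sumF-mono {suc k} le = +-mono-≤ (le zero) (sumF-mono (λ i → le (suc i)))

sumF-+ : ∀ {k} (f g : Fin k → ℕ) → sumF (λ i → f i + g i) ≡ sumF f + sumF g
sumF-+ {zero}  f g = refl
sumF-+ {suc k} f g =
  trans (cong (f zero + g zero +_) (sumF-+ (λ i → f (suc i)) (λ i → g (suc i))))
        (interchange +-commutativeSemigroup (f zero) (g zero) _ _)

sumF-* : ∀ {k} c (f : Fin k → ℕ) → sumF (λ i → c * f i) ≡ c * sumF f
sumF-* {zero}  c f = sym (*-zeroʳ c)
sumF-* {suc k} c f =
  trans (cong (c * f zero +_) (sumF-* c (λ i → f (suc i))))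
        (sym (*-distribˡ-+ c (f zero) _))

sumF-++ : ∀ m {k} (f : Fin (m + k) → ℕ) → sumF f ≡ sumF (take m f) + sumF (drop m f)
sumF-++ zero    f = refl
sumF-++ (suc m) f =
  trans (cong (f zero +_) (sumF-++ m (λ i → f (suc i))))
        (sym (+-assoc (f zero) _ _))

countF-++ : ∀ m {k} (p : Fin (m + k) → Bool) → countF p ≡ countF (take m p) + countF (drop m p)
countF-++ m p =
  trans (countF-sumF p)
        (trans (sumF-++ m _)
               (sym (cong₂ _+_ (countF-sumF (take m p)) (countF-sumF (drop m p)))))

countF-cong : ∀ {k} {p q : Fin k → Bool} → p ≗ q → countF p ≡ countF q
countF-cong {p = p} {q} e =
  trans (countF-sumF p) (trans (sumF-cong (λ i → cong ind (e i))) (sym (countF-sumF q)))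

countF-none : ∀ {k} (p : Fin k → Bool) → (∀ i → p i ≡ false) → countF p ≡ 0
countF-none {zero}  p none = refl
countF-none {suc k} p none rewrite none zero = countF-none (λ i → p (suc i)) (λ i → none (suc i))

countF-+ : ∀ {k} (p q r : Fin k → Bool) → (∀ i → ind (p i) ≡ ind (q i) + ind (r i)) →
  countF p ≡ countF q + countF r
countF-+ p q r e =
  trans (countF-sumF p)
        (trans (sumF-cong e)
               (trans (sumF-+ (λ i → ind (q i)) (λ i → ind (r i)))
                      (sym (cong₂ _+_ (countF-sumF q) (countF-sumF r)))))

anyF-cong : ∀ {k} {p q : Fin k → Bool} → p ≗ q → anyF p ≡ anyF q
anyF-cong {zero}  e = refl
anyF-cong {suc k} e = cong₂ _∨_ (e zero) (anyF-cong (λ i → e (suc i)))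

anyF-++ : ∀ m {k} (p : Fin (m + k) → Bool) → anyF p ≡ anyF (take m p) ∨ anyF (drop m p)
anyF-++ zero    p = refl
anyF-++ (suc m) p =
  trans (cong (p zero ∨_) (anyF-++ m (λ i → p (suc i)))) (sym (∨-assoc (p zero) _ _))

anyF-false : ∀ {k} (p : Fin k → Bool) → anyF p ≡ false → ∀ i → p i ≡ false
anyF-false p none zero    with p zero
anyF-false p ()   zero    | true
anyF-false p none zero    | false = refl
anyF-false p none (suc i) with p zero
anyF-false p ()   (suc i) | true
anyF-false p none (suc i) | false = anyF-false (λ j → p (suc j)) none i

anyF-none : ∀ {k} (p : Fin k → Bool) → (∀ i → p i ≡ false) → anyF p ≡ false
anyF-none {zero}  p none = refl
anyF-none {suc k} p none rewrite none zero = anyF-none (λ j → p (suc j)) (λ j → none (suc j))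

anyF-witness : ∀ {k} (p : Fin k → Bool) → anyF p ≡ true → ∃ λ i → p i ≡ true
anyF-witness {suc k} p some with p zero in p₀
... | true  = zero , p₀
... | false with anyF-witness (λ j → p (suc j)) some
...   | i , pi = suc i , pi

==-refl : ∀ {k} (x : Fin k) → (x == x) ≡ true
==-refl x with x ≟ x
... | yes _  = refl
... | no x≢x = ⊥-elim (x≢x refl)

==⇒≡ : ∀ {k} {x y : Fin k} → (x == y) ≡ true → x ≡ y
==⇒≡ {x = x} {y} eq with x ≟ y
... | yes x≡y = x≡y

≢⇒==false : ∀ {k} {x y : Fin k} → x ≢ y → (x == y) ≡ false
≢⇒==false {x = x} {y} x≢y with x ≟ y
... | yes x≡y = ⊥-elim (x≢y x≡y)
... | no _    = refl

==-injective : ∀ {k l} (φ : Fin k → Fin l) (a b : Fin k) → (φ a ≡ φ b → a ≡ b) →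
  (φ a == φ b) ≡ (a == b)
==-injective φ a b inj with a ≟ b
... | yes refl = ==-refl (φ a)
... | no a≢b   = ≢⇒==false (λ φa≡φb → a≢b (inj φa≡φb))

count-singleton : ∀ {k} (a : Fin k) (R : Fin k → Bool) → countF (λ X → (a == X) ∧ R X) ≡ ind (R a)
count-singleton {suc k} zero R =
  trans (cong (ind (R zero) +_) (countF-none (λ i → (zero == suc i) ∧ R (suc i)) (λ _ → refl)))
        (+-identityʳ _)
count-singleton {suc k} (suc a) R = count-singleton a (λ X → R (suc X))

Even : ℕ → Set
Even c = c % 2 ≡ 0

even-0 : ∀ {c} → c ≡ 0 → Even c
even-0 refl = refl

even-+ : ∀ {a b} → Even a → Even b → Even (a + b)
even-+ {a} {b} ea eb = trans (%-distribˡ-+ a b 2) (cong₂ (λ x y → (x + y) % 2) ea eb)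

even-double : ∀ c → Even (c + c)
even-double c = trans (%-distribˡ-+ c c 2) (double-residue (c % 2) (m%n<n c 2))
  where
  double-residue : ∀ r → r < 2 → (r + r) % 2 ≡ 0
  double-residue 0 _ = refl
  double-residue 1 _ = refl
  double-residue (suc (suc _)) (s≤s (s≤s ()))

parity : ∀ c → c % 2 ≡ 0 ⊎ c % 2 ≡ 1
parity c with c % 2 | m%n<n c 2
... | 0           | _ = inj₁ refl
... | 1           | _ = inj₂ refl
... | suc (suc _) | s≤s (s≤s ())

inImage : ∀ {M n} → (Fin M → Fin n) → Fin n → Bool
inImage f x = anyF (λ u → f u == x)

image-witness : ∀ {M n} (f : Fin M → Fin n) {x} → inImage f x ≡ true → ∃ λ u → f u ≡ x
image-witness f x∈ with anyF-witness _ x∈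
... | u , fu==x = u , ==⇒≡ fu==x

edgeIndicator : ∀ {M n} (G : SimpleGraph M) (f : Fin M → Fin n) (x y : Fin n) → Fin M → Fin M → Bool
edgeIndicator G f x y u v =
  (toℕ u <ᵇ toℕ v) ∧ adj G u v ∧ (((f u == x) ∧ (f v == y)) ∨ ((f u == y) ∧ (f v == x)))

module _ {m n : ℕ} (G : SimpleGraph m) where

  edgeCount-cong : ∀ (f f' : Fin m → Fin n) {x y x' y'} →
    (∀ u → (f u == x) ≡ (f' u == x')) → (∀ u → (f u == y) ≡ (f' u == y')) →
    edgeCount G f x y ≡ edgeCount G f' x' y'
  edgeCount-cong f f' ex ey = sumF-cong λ u → countF-cong λ v →
    cong (λ z → (toℕ u <ᵇ toℕ v) ∧ adj G u v ∧ z)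
         (cong₂ _∨_ (cong₂ _∧_ (ex u) (ey v)) (cong₂ _∧_ (ey u) (ex v)))

  edgeCount-≗ : ∀ {f f' : Fin m → Fin n} → f ≗ f' → ∀ x y → edgeCount G f x y ≡ edgeCount G f' x y
  edgeCount-≗ {f} {f'} e x y =
    edgeCount-cong f f' (λ u → cong (_== x) (e u)) (λ u → cong (_== y) (e u))

  edgeCount-sym : ∀ (f : Fin m → Fin n) x y → edgeCount G f x y ≡ edgeCount G f y x
  edgeCount-sym f x y = sumF-cong λ u → countF-cong λ v →
    cong (λ z → (toℕ u <ᵇ toℕ v) ∧ adj G u v ∧ z) (∨-comm ((f u == x) ∧ (f v == y)) _)

  edgeCount-outside : ∀ (f : Fin m → Fin n) x y → inImage f x ≡ false → edgeCount G f x y ≡ 0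
  edgeCount-outside f x y x∉ = sumF-zero λ u → countF-none _ λ v → no-edge u v
    where
    sumF-zero : ∀ {k} {g : Fin k → ℕ} → (∀ i → g i ≡ 0) → sumF g ≡ 0
    sumF-zero {k} zeros = trans (sumF-cong zeros) (sumF-0 k)
      where
      sumF-0 : ∀ k → sumF {k} (λ _ → 0) ≡ 0
      sumF-0 zero    = refl
      sumF-0 (suc k) = sumF-0 k
    no-edge : ∀ u v → edgeIndicator G f x y u v ≡ false
    no-edge u v rewrite anyF-false _ x∉ u | anyF-false _ x∉ v
                      | ∧-zeroʳ (f u == y) | ∧-zeroʳ (adj G u v) = ∧-zeroʳ (toℕ u <ᵇ toℕ v)

  evenEdges⇒IsEven : ∀ (f : Fin m → Fin n) → (∀ x y → x ≢ y → Even (edgeCount G f x y)) → IsEven G f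
  evenEdges⇒IsEven f even x y with x ≟ y
  ... | yes refl = refl
  ... | no x≢y rewrite even x y x≢y = refl

  oddVertex-inImage : ∀ (f : Fin m → Fin n) x → isOddVertex G f x ≡ true → inImage f x ≡ true
  oddVertex-inImage f x odd with inImage f x in x∈?
  ... | true  = refl
  ... | false = sym (trans (sym odd) (anyF-none _ no-odd-edge))
    where
    no-odd-edge : ∀ y → isOddEdge G f x y ≡ false
    no-odd-edge y rewrite edgeCount-outside f x y x∈? = ∧-zeroʳ _

  notInImage-even : ∀ (f : Fin m → Fin n) x → inImage f x ≡ false → isOddVertex G f x ≡ false
  notInImage-even f x x∉ with isOddVertex G f x in odd
  ... | false = refl
  ... | true  = trans (sym (oddVertex-inImage f x odd)) x∉

  evenVertex-evenEdge : ∀ (f : Fin m → Fin n) x y → isOddVertex G f x ≡ false → x ≢ y →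
    Even (edgeCount G f x y)
  evenVertex-evenEdge f x y x-even x≢y with parity (edgeCount G f x y)
  ... | inj₁ ev = ev
  ... | inj₂ od with anyF-false _ x-even y   -- an odd count would make xy odd
  ...   | xy-even rewrite ≢⇒==false x≢y | od with xy-even
  ...     | ()

  even⇒twiceR : ∀ (f : Fin m → Fin n) → IsEven G f → twiceR G f ≡ 2 * defect G f
  even⇒twiceR f ev =
    trans (cong (2 * defect G f +_) (countF-none _ (λ x → anyF-none _ (ev x)))) (+-identityʳ _)

-- Counting distinct values of a map

-- distinct f Q: the number of values x of f with Q x.  Position i counts
-- when f i satisfies Q and does not recur later in f.
distinct : ∀ {M n} → (Fin M → Fin n) → (Fin n → Bool) → ℕ
distinct {zero}  f Q = 0
distinct {suc M} f Q =
  ind (not (inImage (λ i → f (suc i)) (f zero)) ∧ Q (f zero)) + distinct (λ i → f (suc i)) Q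

module _ {n : ℕ} where

  count-image : ∀ {M} (f : Fin M → Fin n) Q → countF (λ X → inImage f X ∧ Q X) ≡ distinct f Q
  count-image {zero}  f Q = countF-none (λ X → inImage f X ∧ Q X) (λ _ → refl)
  count-image {suc M} f Q = begin
      countF (λ X → inImage f X ∧ Q X)
    ≡⟨ countF-+ _ _ _ (λ X → new-or-old (f zero == X) (inImage tail X) (Q X)) ⟩
      countF (λ X → inImage tail X ∧ Q X)
        + countF (λ X → (f zero == X) ∧ (not (inImage tail X) ∧ Q X))
    ≡⟨ cong₂ _+_ (count-image tail Q) (count-singleton (f zero) _) ⟩
      distinct tail Q + ind (not (inImage tail (f zero)) ∧ Q (f zero))
    ≡⟨ +-comm (distinct tail Q) _ ⟩
      distinct f Q
    ∎
    where
    open ≡-Reasoning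
    tail : Fin M → Fin n
    tail i = f (suc i)
    new-or-old : ∀ a b q → ind ((a ∨ b) ∧ q) ≡ ind (b ∧ q) + ind (a ∧ (not b ∧ q))
    new-or-old true  true  q     = sym (+-identityʳ (ind q))
    new-or-old true  false q     = refl
    new-or-old false b     q     = sym (+-identityʳ (ind (b ∧ q)))

  imageSize≡distinct : ∀ {M} (G : SimpleGraph M) (f : Fin M → Fin n) → imageSize G f ≡ distinct f (λ _ → true)
  imageSize≡distinct G f = trans (countF-cong (λ X → sym (∧-identityʳ (inImage f X)))) (count-image f _)

  numOdd≡distinct : ∀ {M} (G : SimpleGraph M) (f : Fin M → Fin n) → numOdd G f ≡ distinct f (isOddVertex G f)
  numOdd≡distinct G f = trans (countF-cong odd-in-image) (count-image f _)
    where
    odd-in-image : ∀ X → isOddVertex G f X ≡ inImage f X ∧ isOddVertex G f X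
    odd-in-image X with isOddVertex G f X in odd
    ... | false = sym (∧-zeroʳ _)
    ... | true rewrite oddVertex-inImage G f X odd = refl

  distinct≤ : ∀ {M} (f : Fin M → Fin n) Q → distinct f Q ≤ M
  distinct≤ {zero}  f Q = z≤n
  distinct≤ {suc M} f Q = +-mono-≤ (ind≤1 _) (distinct≤ (λ i → f (suc i)) Q)

  imageSize≤ : ∀ {M} (G : SimpleGraph M) (f : Fin M → Fin n) → imageSize G f ≤ M
  imageSize≤ G f = ≤-trans (≤-reflexive (imageSize≡distinct G f)) (distinct≤ f _)

  distinct-mono : ∀ {M} (f : Fin M → Fin n) (Q Q' : Fin n → Bool) →
    (∀ u → Q (f u) ≡ true → Q' (f u) ≡ true) → distinct f Q ≤ distinct f Q'
  distinct-mono {zero}  f Q Q' imp = z≤n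
  distinct-mono {suc M} f Q Q' imp =
    +-mono-≤ (ind-∧-mono _ (Q (f zero)) (Q' (f zero)) (imp zero))
             (distinct-mono (λ i → f (suc i)) Q Q' (λ u → imp (suc u)))
    where
    ind-∧-mono : ∀ a q q' → (q ≡ true → q' ≡ true) → ind (a ∧ q) ≤ ind (a ∧ q')
    ind-∧-mono false q     q' _   = z≤n
    ind-∧-mono true  false q' _   = z≤n
    ind-∧-mono true  true  q' imp rewrite imp refl = ≤-refl

  distinct-split : ∀ {M} (f : Fin M → Fin n) (P : Fin n → Bool) →
    distinct f (λ _ → true) ≡ distinct f P + distinct f (λ x → not (P x))
  distinct-split {zero}  f P = refl
  distinct-split {suc M} f P =
    trans (cong₂ _+_ (ind-split new (P (f zero)))
                     (distinct-split (λ i → f (suc i)) P))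
          (interchange +-commutativeSemigroup (ind (new ∧ P (f zero))) (ind (new ∧ not (P (f zero))))
                       (distinct (λ i → f (suc i)) P) (distinct (λ i → f (suc i)) (λ x → not (P x))))
    where
    new : Bool
    new = not (inImage (λ i → f (suc i)) (f zero))
    ind-split : ∀ a p → ind (a ∧ true) ≡ ind (a ∧ p) + ind (a ∧ not p)
    ind-split false p     = refl
    ind-split true  true  = refl
    ind-split true  false = refl

  distinct-relabel : ∀ {M} (f : Fin M → Fin n) (φ : Fin n → Fin n) Q →
    (∀ u v → φ (f u) ≡ φ (f v) → f u ≡ f v) → distinct (λ u → φ (f u)) Q ≡ distinct f (λ x → Q (φ x))
  distinct-relabel {zero}  f φ Q inj = refl
  distinct-relabel {suc M} f φ Q inj = cong₂ _+_
    (cong (λ z → ind (not z ∧ Q (φ (f zero))))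
          (anyF-cong λ v → ==-injective φ (f (suc v)) (f zero) (inj (suc v) zero)))
    (distinct-relabel (λ i → f (suc i)) φ Q (λ u v → inj (suc u) (suc v)))

  distinct-≗ : ∀ {M} {f f' : Fin M → Fin n} {Q Q' : Fin n → Bool} → f ≗ f' → Q ≗ Q' →
    distinct f Q ≡ distinct f' Q'
  distinct-≗ {zero}              ef eQ = refl
  distinct-≗ {suc M} {f} {f'} {Q} {Q'} ef eQ = cong₂ _+_
    (cong₂ (λ a q → ind (not a ∧ q))
           (anyF-cong λ v → cong₂ _==_ (ef (suc v)) (ef zero))
           (trans (cong Q (ef zero)) (eQ (f' zero))))
    (distinct-≗ (λ i → ef (suc i)) eQ)

  distinct-++ : ∀ m {k} (f : Fin (m + k) → Fin n) Q →
    distinct f Q ≡ distinct (take m f) (λ x → not (inImage (drop m f) x) ∧ Q x) + distinct (drop m f) Q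
  distinct-++ zero    f Q = refl
  distinct-++ (suc m) {k} f Q =
    trans (cong₂ _+_ (cong ind (trans (cong (λ z → not z ∧ Q (f zero)) (anyF-++ m _))
                                      (de-morgan (inImage (take m tail) (f zero))
                                                 (inImage (drop m tail) (f zero)) (Q (f zero)))))
                     (distinct-++ m tail Q))
          (sym (+-assoc (ind (not (inImage (take m tail) (f zero))
                              ∧ (not (inImage (drop m tail) (f zero)) ∧ Q (f zero)))) _ _))
    where
    tail : Fin (m + k) → Fin n
    tail i = f (suc i)
    de-morgan : ∀ a b q → (not (a ∨ b) ∧ q) ≡ (not a ∧ (not b ∧ q))
    de-morgan true  b     q = refl
    de-morgan false true  q = refl
    de-morgan false false q = refl

-- (1) in terms of image sizes a, b, c and odd-vertex numbers o₁, o₂, o of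
-- f₁, f₂ and f, given the summed pointwise bound.
split-arith : ∀ {m k a b c o₁ o₂ o} → a ≤ m → b ≤ k →
  o₁ + o₂ + 2 * c ≤ 2 * a + 2 * b + o →
  2 * (m ∸ a) + o₁ + (2 * (k ∸ b) + o₂) ≤ 2 * ((m + k) ∸ c) + o
split-arith {m} {k} {a} {b} {c} {o₁} {o₂} {o} a≤m b≤k bound = +-cancelʳ-≤ (2 * c) _ _ (begin
    2 * d₁ + o₁ + (2 * d₂ + o₂) + 2 * c  ≡⟨ regroup₁ d₁ d₂ o₁ o₂ c ⟩
    2 * d₁ + 2 * d₂ + (o₁ + o₂ + 2 * c)  ≤⟨ +-monoʳ-≤ (2 * d₁ + 2 * d₂) bound ⟩
    2 * d₁ + 2 * d₂ + (2 * a + 2 * b + o) ≡⟨ regroup₂ d₁ d₂ a b o ⟩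
    2 * ((d₁ + a) + (d₂ + b)) + o         ≡⟨ cong₂ (λ x y → 2 * (x + y) + o) (m∸n+n≡m a≤m) (m∸n+n≡m b≤k) ⟩
    2 * (m + k) + o                       ≤⟨ +-monoˡ-≤ o (*-monoʳ-≤ 2 (m≤n+m∸n (m + k) c)) ⟩
    2 * (c + e) + o                       ≡⟨ regroup₃ c e o ⟩
    2 * e + o + 2 * c                     ∎)
  where
  open ≤-Reasoning
  d₁ d₂ e : ℕ
  d₁ = m ∸ a
  d₂ = k ∸ b
  e = (m + k) ∸ c
  regroup₁ : ∀ d₁ d₂ o₁ o₂ c → 2 * d₁ + o₁ + (2 * d₂ + o₂) + 2 * c ≡ 2 * d₁ + 2 * d₂ + (o₁ + o₂ + 2 * c)
  regroup₁ = solve-∀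
  regroup₂ : ∀ d₁ d₂ a b o → 2 * d₁ + 2 * d₂ + (2 * a + 2 * b + o) ≡ 2 * ((d₁ + a) + (d₂ + b)) + o
  regroup₂ = solve-∀
  regroup₃ : ∀ c e o → 2 * (c + e) + o ≡ 2 * e + o + 2 * c
  regroup₃ = solve-∀

-- Defect of the doubled map from the image bound |g(V)| ≥ t + a, a = o + t.
doubling-arith : ∀ {m a o t s} → a ≤ m → a ≡ o + t → t + a ≤ s → (m + m) ∸ s ≤ 2 * (m ∸ a) + o
doubling-arith {m} {a} {o} {t} {s} a≤m a≡o+t t+a≤s = m≤n+o⇒m∸n≤o (m + m) s (begin
    m + m                       ≡⟨ cong₂ _+_ (sym (m∸n+n≡m a≤m)) (sym (m∸n+n≡m a≤m)) ⟩
    (d + a) + (d + a)           ≡⟨ cong (λ z → (d + a) + (d + z)) a≡o+t ⟩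
    (d + a) + (d + (o + t))     ≡⟨ regroup d a o t ⟩
    (t + a) + (2 * d + o)       ≤⟨ +-monoˡ-≤ (2 * d + o) t+a≤s ⟩
    s + (2 * d + o)             ∎)
  where
  open ≤-Reasoning
  d : ℕ
  d = m ∸ a
  regroup : ∀ d a o t → (d + a) + (d + (o + t)) ≡ (t + a) + (2 * d + o)
  regroup = solve-∀

-- Pointwise form of (1) at a vertex X of K_n: iₖ says X is a value of fₖ,
-- oₖ that X is fₖ-odd, o that X is f-odd.
split-bound : ∀ i₁ i₂ o₁ o₂ o →
  (i₁ ≡ false → o₁ ≡ false × o ≡ o₂) → (i₂ ≡ false → o₂ ≡ false × o ≡ o₁) →
  ind o₁ + ind o₂ + 2 * ind (i₁ ∨ i₂) ≤ 2 * ind i₁ + 2 * ind i₂ + ind o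
split-bound true true o₁ o₂ o _ _ =
  ≤-trans (+-monoˡ-≤ 2 (+-mono-≤ (ind≤1 o₁) (ind≤1 o₂))) (m≤m+n 4 (ind o))
split-bound true false o₁ o₂ o _ not₂ with not₂ refl
... | refl , refl = ≤-reflexive (trans (+-comm (ind o₁ + 0) 2) (cong (2 +_) (+-identityʳ (ind o₁))))
split-bound false true o₁ o₂ o not₁ _ with not₁ refl
... | refl , refl = ≤-reflexive (+-comm (ind o₂) 2)
split-bound false false o₁ o₂ o not₁ not₂ with not₁ refl | not₂ refl
... | refl , _ | refl , _ = z≤n

twice-min : ∀ {a b} → a ≤ b → 2 * a ≤ a + b
twice-min {a} a≤b = +-monoʳ-≤ a (≤-trans (≤-reflexive (+-identityʳ a)) a≤b)

-- Disjoint unions G ⊕ H; the splitting inequality (1)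

module DisjointUnion {m k n : ℕ} (G : SimpleGraph m) (H : SimpleGraph k) where

  adj-left : ∀ i j → adj (G ⊕ H) (i ↑ˡ k) (j ↑ˡ k) ≡ adj G i j
  adj-left i j rewrite splitAt-↑ˡ m i k | splitAt-↑ˡ m j k = refl

  adj-right : ∀ i j → adj (G ⊕ H) (m ↑ʳ i) (m ↑ʳ j) ≡ adj H i j
  adj-right i j rewrite splitAt-↑ʳ m k i | splitAt-↑ʳ m k j = refl

  adj-across : ∀ i j → adj (G ⊕ H) (i ↑ˡ k) (m ↑ʳ j) ≡ false
  adj-across i j rewrite splitAt-↑ˡ m i k | splitAt-↑ʳ m k j = refl

  adj-across' : ∀ i j → adj (G ⊕ H) (m ↑ʳ i) (j ↑ˡ k) ≡ false
  adj-across' i j rewrite splitAt-↑ʳ m k i | splitAt-↑ˡ m j k = refl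

  hom-take : ∀ {f : Fin (m + k) → Fin n} → IsHom (G ⊕ H) n f → IsHom G n (take m f)
  hom-take hom i j a = hom (i ↑ˡ k) (j ↑ˡ k) (trans (adj-left i j) a)

  hom-drop : ∀ {f : Fin (m + k) → Fin n} → IsHom (G ⊕ H) n f → IsHom H n (drop m f)
  hom-drop hom i j a = hom (m ↑ʳ i) (m ↑ʳ j) (trans (adj-right i j) a)

  hom-++ : ∀ {f₁ : Fin m → Fin n} {f₂ : Fin k → Fin n} → IsHom G n f₁ → IsHom H n f₂ →
    IsHom (G ⊕ H) n (f₁ ++ f₂)
  hom-++ hom₁ hom₂ u v a with splitAt m u | splitAt m v
  ... | inj₁ i | inj₁ j = hom₁ i j a
  ... | inj₂ i | inj₂ j = hom₂ i j a
  ... | inj₁ _ | inj₂ _ with a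
  ...   | ()
  hom-++ hom₁ hom₂ u v a | inj₂ _ | inj₁ _ with a
  ...   | ()

  -- Edges of G ⊕ H lie inside one of the two copies.
  edgeCount-⊕ : ∀ (f : Fin (m + k) → Fin n) X Y →
    edgeCount (G ⊕ H) f X Y ≡ edgeCount G (take m f) X Y + edgeCount H (drop m f) X Y
  edgeCount-⊕ f X Y =
    trans (sumF-++ m _) (cong₂ _+_ (sumF-cong left-row) (sumF-cong right-row))
    where
    E : Fin (m + k) → Fin (m + k) → Bool
    E = edgeIndicator (G ⊕ H) f X Y
    shift-<ᵇ : ∀ l a b → (l + a <ᵇ l + b) ≡ (a <ᵇ b)
    shift-<ᵇ zero    a b = refl
    shift-<ᵇ (suc l) a b = shift-<ᵇ l a b
    left-row : ∀ i → countF (E (i ↑ˡ k)) ≡ countF (edgeIndicator G (take m f) X Y i)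
    left-row i = trans (countF-++ m _)
      (trans (cong₂ _+_ (countF-cong inside) (countF-none _ across)) (+-identityʳ _))
      where
      inside : ∀ j → E (i ↑ˡ k) (j ↑ˡ k) ≡ edgeIndicator G (take m f) X Y i j
      inside j rewrite toℕ-↑ˡ i k | toℕ-↑ˡ j k | adj-left i j = refl
      across : ∀ j → E (i ↑ˡ k) (m ↑ʳ j) ≡ false
      across j rewrite adj-across i j = ∧-zeroʳ _
    right-row : ∀ i → countF (E (m ↑ʳ i)) ≡ countF (edgeIndicator H (drop m f) X Y i)
    right-row i = trans (countF-++ m _) (cong₂ _+_ (countF-none _ across) (countF-cong inside))
      where
      inside : ∀ j → E (m ↑ʳ i) (m ↑ʳ j) ≡ edgeIndicator H (drop m f) X Y i j
      inside j rewrite toℕ-↑ʳ m i | toℕ-↑ʳ m j | shift-<ᵇ m (toℕ i) (toℕ j) | adj-right i j = refl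
      across : ∀ j → E (m ↑ʳ i) (j ↑ˡ k) ≡ false
      across j rewrite adj-across' i j = ∧-zeroʳ _

  imageSize-⊕ : ∀ (f : Fin (m + k) → Fin n) →
    imageSize (G ⊕ H) f ≡ countF (λ X → inImage (take m f) X ∨ inImage (drop m f) X)
  imageSize-⊕ f = countF-cong λ X → anyF-++ m (λ u → f u == X)

  oddVertex-⊕ˡ : ∀ (f : Fin (m + k) → Fin n) X → inImage (drop m f) X ≡ false →
    isOddVertex (G ⊕ H) f X ≡ isOddVertex G (take m f) X
  oddVertex-⊕ˡ f X X∉ = anyF-cong λ Y → cong (λ c → not (X == Y) ∧ (c % 2 ≡ᵇ 1))
    (trans (edgeCount-⊕ f X Y)
           (trans (cong (edgeCount G (take m f) X Y +_) (edgeCount-outside H (drop m f) X Y X∉))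
                  (+-identityʳ _)))

  oddVertex-⊕ʳ : ∀ (f : Fin (m + k) → Fin n) X → inImage (take m f) X ≡ false →
    isOddVertex (G ⊕ H) f X ≡ isOddVertex H (drop m f) X
  oddVertex-⊕ʳ f X X∉ = anyF-cong λ Y → cong (λ c → not (X == Y) ∧ (c % 2 ≡ᵇ 1))
    (trans (edgeCount-⊕ f X Y) (cong (_+ edgeCount H (drop m f) X Y) (edgeCount-outside G (take m f) X Y X∉)))

  twiceR-⊕ : ∀ (f : Fin (m + k) → Fin n) → twiceR G (take m f) + twiceR H (drop m f) ≤ twiceR (G ⊕ H) f
  twiceR-⊕ f =
    subst (λ c → twiceR G f₁ + twiceR H f₂ ≤ 2 * ((m + k) ∸ c) + numOdd (G ⊕ H) f)
          (sym (imageSize-⊕ f))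
          (split-arith {c = countF i} (imageSize≤ G f₁) (imageSize≤ H f₂) summed)
    where
    open ≤-Reasoning
    f₁ : Fin m → Fin n
    f₁ = take m f
    f₂ : Fin k → Fin n
    f₂ = drop m f
    i₁ i₂ i o₁ o₂ o : Fin n → Bool
    i₁ = inImage f₁
    i₂ = inImage f₂
    i X = i₁ X ∨ i₂ X
    o₁ = isOddVertex G f₁
    o₂ = isOddVertex H f₂
    o = isOddVertex (G ⊕ H) f
    pointwise : ∀ X → ind (o₁ X) + ind (o₂ X) + 2 * ind (i X) ≤ 2 * ind (i₁ X) + 2 * ind (i₂ X) + ind (o X)
    pointwise X = split-bound (i₁ X) (i₂ X) (o₁ X) (o₂ X) (o X)
      (λ X∉₁ → notInImage-even G f₁ X X∉₁ , oddVertex-⊕ʳ f X X∉₁)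
      (λ X∉₂ → notInImage-even H f₂ X X∉₂ , oddVertex-⊕ˡ f X X∉₂)
    Σ-count : ∀ c (p : Fin n → Bool) → sumF (λ X → c * ind (p X)) ≡ c * countF p
    Σ-count c p = trans (sumF-* c (λ X → ind (p X))) (cong (c *_) (sym (countF-sumF p)))
    Σ-combine : ∀ {f g h : Fin n → ℕ} {a b c} → sumF f ≡ a → sumF g ≡ b → sumF h ≡ c →
      sumF (λ X → f X + g X + h X) ≡ a + b + c
    Σ-combine {f} {g} {h} ef eg eh =
      trans (trans (sumF-+ (λ X → f X + g X) h) (cong (_+ sumF h) (sumF-+ f g)))
            (cong₂ _+_ (cong₂ _+_ ef eg) eh)
    summed : countF o₁ + countF o₂ + 2 * countF i ≤ 2 * countF i₁ + 2 * countF i₂ + countF o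
    summed = begin
      countF o₁ + countF o₂ + 2 * countF i
        ≡⟨ sym (Σ-combine (sym (countF-sumF o₁)) (sym (countF-sumF o₂)) (Σ-count 2 i)) ⟩
      sumF (λ X → ind (o₁ X) + ind (o₂ X) + 2 * ind (i X))
        ≤⟨ sumF-mono pointwise ⟩
      sumF (λ X → 2 * ind (i₁ X) + 2 * ind (i₂ X) + ind (o X))
        ≡⟨ Σ-combine (Σ-count 2 i₁) (Σ-count 2 i₂) (sym (countF-sumF o)) ⟩
      2 * countF i₁ + 2 * countF i₂ + countF o ∎

module Relabel {m n : ℕ} (G : SimpleGraph m) (h : Fin m → Fin n) (φ : Fin n → Fin n)
       (φ-inj : ∀ u v → φ (h u) ≡ φ (h v) → h u ≡ h v) where

  relabelled : Fin m → Fin n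
  relabelled u = φ (h u)

  relabel-hom : IsHom G n h → IsHom G n relabelled
  relabel-hom hom u v a same = hom u v a (φ-inj u v same)

  relabel-distinct : ∀ Q → distinct relabelled Q ≡ distinct h (λ x → Q (φ x))
  relabel-distinct Q = distinct-relabel h φ Q φ-inj

  relabel-edgeCount : ∀ u v → edgeCount G relabelled (relabelled u) (relabelled v) ≡ edgeCount G h (h u) (h v)
  relabel-edgeCount u v = edgeCount-cong G relabelled h
    (λ w → ==-injective φ (h w) (h u) (φ-inj w u))
    (λ w → ==-injective φ (h w) (h v) (φ-inj w v))

  OddPair : Fin n → Fin n → Set
  OddPair X Y = ∃ λ u → ∃ λ v → relabelled u ≡ X × relabelled v ≡ Y
    × isOddVertex G h (h u) ≡ true × isOddVertex G h (h v) ≡ true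

  pair-parity : ∀ u v → relabelled u ≢ relabelled v →
    Even (edgeCount G relabelled (relabelled u) (relabelled v)) ⊎ OddPair (relabelled u) (relabelled v)
  pair-parity u v distinctValues
    with isOddVertex G h (h u) in odd-u | isOddVertex G h (h v) in odd-v
  ... | true  | true  = inj₂ (u , v , refl , refl , odd-u , odd-v)
  ... | false | _     = inj₁ (subst Even (sym (relabel-edgeCount u v))
                          (evenVertex-evenEdge G h (h u) (h v) odd-u (λ e → distinctValues (cong φ e))))
  ... | true  | false = inj₁ (subst Even (sym (trans (edgeCount-sym G relabelled _ _) (relabel-edgeCount v u)))
                          (evenVertex-evenEdge G h (h v) (h u) odd-v (λ e → distinctValues (cong φ (sym e)))))

  even-or-oddPair : ∀ X Y → X ≢ Y → Even (edgeCount G relabelled X Y) ⊎ OddPair X Y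
  even-or-oddPair X Y X≢Y with inImage relabelled X in X∈? | inImage relabelled Y in Y∈?
  ... | false | _     = inj₁ (even-0 (edgeCount-outside G relabelled X Y X∈?))
  ... | true  | false = inj₁ (even-0 (trans (edgeCount-sym G relabelled X Y) (edgeCount-outside G relabelled Y X Y∈?)))
  ... | true  | true  with image-witness relabelled X∈? | image-witness relabelled Y∈?
  ...   | u , refl | v , refl = pair-parity u v X≢Y

module Representatives {m n : ℕ} (h : Fin m → Fin n) where

  through : (Fin m → Fin n) → Fin n → Fin n
  through j x with any? (λ w → h w ≟ x)
  ... | yes (w , _) = j w
  ... | no _        = x

  through-rep : ∀ j u → ∃ λ w → through j (h u) ≡ j w × h w ≡ h u
  through-rep j u with any? (λ w → h w ≟ h u)
  ... | yes (w , hw≡hu) = w , refl , hw≡hu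
  ... | no none         = ⊥-elim (none (u , refl))

  through-injective : ∀ {j} → (∀ a b → j a ≡ j b → a ≡ b) →
    ∀ u v → through j (h u) ≡ through j (h v) → h u ≡ h v
  through-injective {j} j-inj u v same with through-rep j u | through-rep j v
  ... | w , tu , hw | w' , tv , hw' =
    trans (sym hw) (trans (cong h (j-inj w w' (trans (sym tu) (trans same tv)))) hw')

  through-disjoint : ∀ {j j'} → (∀ a b → j a ≢ j' b) → ∀ u v → through j (h u) ≢ through j' (h v)
  through-disjoint {j} {j'} disj u v same with through-rep j u | through-rep j' v
  ... | w , tu , _ | w' , tv , _ = disj w w' (trans (sym tu) (trans same tv))

-- Even doubling (2)

module EvenDoubling {m n : ℕ} (G : SimpleGraph m) (m+m≤n : m + m ≤ n) (h : Fin m → Fin n) where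

  open Representatives h
  open DisjointUnion {n = n} G G

  block₁ block₂ : Fin m → Fin n
  block₁ w = inject≤ (w ↑ˡ m) m+m≤n
  block₂ w = inject≤ (m ↑ʳ w) m+m≤n

  block₁-injective : ∀ a b → block₁ a ≡ block₁ b → a ≡ b
  block₁-injective a b e = ↑ˡ-injective m a b (inject≤-injective m+m≤n m+m≤n _ _ e)

  block₂-injective : ∀ a b → block₂ a ≡ block₂ b → a ≡ b
  block₂-injective a b e = ↑ʳ-injective m a b (inject≤-injective m+m≤n m+m≤n _ _ e)

  blocks-disjoint : ∀ a b → block₁ a ≢ block₂ b
  blocks-disjoint a b e = <⇒≢ (≤-trans (toℕ<n a) (m≤m+n m (toℕ b))) (begin
      toℕ a                       ≡⟨ sym (toℕ-↑ˡ a m) ⟩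
      toℕ (a ↑ˡ m)                ≡⟨ sym (toℕ-inject≤ (a ↑ˡ m) m+m≤n) ⟩
      toℕ (block₁ a)              ≡⟨ cong toℕ e ⟩
      toℕ (block₂ b)              ≡⟨ toℕ-inject≤ (m ↑ʳ b) m+m≤n ⟩
      toℕ (m ↑ʳ b)                ≡⟨ toℕ-↑ʳ m b ⟩
      m + toℕ b                   ∎)
    where open ≡-Reasoning

  odd : Fin n → Bool
  odd = isOddVertex G h

  e₁ e₂ e : Fin n → Fin n
  e₁ = through block₁
  e₂ = through block₂
  e x = if odd x then e₁ x else e₂ x

  e₁-injective : ∀ u v → e₁ (h u) ≡ e₁ (h v) → h u ≡ h v
  e₁-injective = through-injective block₁-injective

  e-injective : ∀ u v → e (h u) ≡ e (h v) → h u ≡ h v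
  e-injective u v same with odd (h u) | odd (h v)
  ... | true  | true  = e₁-injective u v same
  ... | false | false = through-injective block₂-injective u v same
  ... | true  | false = ⊥-elim (through-disjoint blocks-disjoint u v same)
  ... | false | true  = ⊥-elim (through-disjoint blocks-disjoint v u (sym same))

  module First = Relabel G h e₁ e₁-injective
  module Second = Relabel G h e e-injective

  k₁ k₂ : Fin m → Fin n
  k₁ = First.relabelled
  k₂ = Second.relabelled

  g : Fin (m + m) → Fin n
  g = k₁ ++ k₂

  k₂-odd : ∀ u → odd (h u) ≡ true → k₂ u ≡ k₁ u
  k₂-odd u odd-u rewrite odd-u = refl

  k₁-even-fresh : ∀ u → odd (h u) ≡ false → inImage k₂ (k₁ u) ≡ false
  k₁-even-fresh u even-u = anyF-none _ λ w → ≢⇒==false (clash w)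
    where
    clash : ∀ w → k₂ w ≢ k₁ u
    clash w same with odd (h w) in odd-w
    ... | true  with trans (sym even-u) (trans (cong odd (sym (e₁-injective w u same))) odd-w)
    ...   | ()
    clash w same | false = through-disjoint blocks-disjoint u w (sym same)

  g-edgeCount : ∀ X Y → edgeCount (square G) g X Y ≡ edgeCount G k₁ X Y + edgeCount G k₂ X Y
  g-edgeCount X Y = trans (edgeCount-⊕ g X Y)
    (cong₂ _+_ (edgeCount-≗ G (lookup-++ˡ k₁ k₂) X Y) (edgeCount-≗ G (lookup-++ʳ k₁ k₂) X Y))

  -- Between the common colours of two h-odd values both copies contribute
  -- the same h-edge count.
  shared-even : ∀ u v → odd (h u) ≡ true → odd (h v) ≡ true →
    Even (edgeCount G k₁ (k₁ u) (k₁ v) + edgeCount G k₂ (k₁ u) (k₁ v))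
  shared-even u v odd-u odd-v =
    subst Even (cong₂ _+_ (sym (First.relabel-edgeCount u v)) (sym second-copy))
               (even-double (edgeCount G h (h u) (h v)))
    where
    second-copy : edgeCount G k₂ (k₁ u) (k₁ v) ≡ edgeCount G h (h u) (h v)
    second-copy = trans (cong₂ (edgeCount G k₂) (sym (k₂-odd u odd-u)) (sym (k₂-odd v odd-v)))
                        (Second.relabel-edgeCount u v)

  g-even : IsEven (square G) g
  g-even = evenEdges⇒IsEven (square G) g λ X Y X≢Y →
    subst Even (sym (g-edgeCount X Y)) (both-copies X Y X≢Y)
    where
    both-copies : ∀ X Y → X ≢ Y → Even (edgeCount G k₁ X Y + edgeCount G k₂ X Y)
    both-copies X Y X≢Y with First.even-or-oddPair X Y X≢Y
    ... | inj₂ (u , v , refl , refl , odd-u , odd-v) = shared-even u v odd-u odd-v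
    ... | inj₁ even₁ with Second.even-or-oddPair X Y X≢Y
    ...   | inj₁ even₂ = even-+ {edgeCount G k₁ X Y} {edgeCount G k₂ X Y} even₁ even₂
    ...   | inj₂ (u , v , refl , refl , odd-u , odd-v)
      rewrite k₂-odd u odd-u | k₂-odd v odd-v = shared-even u v odd-u odd-v

  g-image : distinct h (λ x → not (odd x)) + imageSize G h ≤ imageSize (square G) g
  g-image = begin
      distinct h (λ x → not (odd x)) + imageSize G h
    ≤⟨ +-mono-≤ (distinct-mono h _ _ fresh) (≤-reflexive (imageSize≡distinct G h)) ⟩
      distinct h (λ x → not (inImage k₂ (e₁ x)) ∧ true) + distinct h (λ _ → true)
    ≡⟨ sym (cong₂ _+_ (First.relabel-distinct _) (Second.relabel-distinct _)) ⟩
      distinct k₁ (λ x → not (inImage k₂ x) ∧ true) + distinct k₂ (λ _ → true)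
    ≡⟨ sym (cong₂ _+_ (distinct-≗ (lookup-++ˡ k₁ k₂) (λ x → cong (λ b → not b ∧ true) (anyF-cong λ u → cong (_== x) (lookup-++ʳ k₁ k₂ u))))
                      (distinct-≗ (lookup-++ʳ k₁ k₂) (λ _ → refl))) ⟩
      distinct (take m g) (λ x → not (inImage (drop m g) x) ∧ true) + distinct (drop m g) (λ _ → true)
    ≡⟨ sym (trans (imageSize≡distinct (square G) g) (distinct-++ m g _)) ⟩
      imageSize (square G) g
    ∎
    where
    open ≤-Reasoning
    fresh : ∀ u → not (odd (h u)) ≡ true → not (inImage k₂ (k₁ u)) ∧ true ≡ true
    fresh u not-odd with odd (h u) in odd-u
    fresh u refl | false rewrite k₁-even-fresh u odd-u = refl

  g-defect : defect (square G) g ≤ twiceR G h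
  g-defect = doubling-arith (imageSize≤ G h) odd-plus-even g-image
    where
    odd-plus-even : imageSize G h ≡ numOdd G h + distinct h (λ x → not (odd x))
    odd-plus-even = trans (imageSize≡distinct G h)
      (trans (distinct-split h odd) (cong (_+ distinct h (λ x → not (odd x))) (sym (numOdd≡distinct G h))))

  g-hom : IsHom G n h → IsHom (square G) n g
  g-hom hom = hom-++ (First.relabel-hom hom) (Second.relabel-hom hom)

evenDoubling : ∀ {m n} (G : SimpleGraph m) → m + m ≤ n → (h : Fin m → Fin n) → IsHom G n h →
  ∃ λ g → (IsHom (square G) n g × IsEven (square G) g) × defect (square G) g ≤ twiceR G h
evenDoubling G m+m≤n h hom = g , (g-hom hom , g-even) , g-defect
  where open EvenDoubling G m+m≤n h

-- Minima over the finite set of maps Fin M → Fin n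

Extensional : ∀ {M n} → ((Fin M → Fin n) → Set) → Set
Extensional P = ∀ {f f'} → f ≗ f' → P f → P f'

∃-map? : ∀ {M n} (P : (Fin M → Fin n) → Set) → (∀ f → Dec (P f)) → Extensional P → Dec (∃ P)
∃-map? {zero} P P? ext with P? (λ ())
... | yes p  = yes ((λ ()) , p)
... | no ¬p = no λ (f , pf) → ¬p (ext (λ ()) pf)
∃-map? {suc M} P P? ext
  with any? (λ x → ∃-map? (λ f → P (x ∷ f)) (λ f → P? (x ∷ f)) (λ e → ext (cons-≗ e)))
  where
  cons-≗ : ∀ {x} {f f' : Fin M → _} → f ≗ f' → (x ∷ f) ≗ (x ∷ f')
  cons-≗ e zero    = refl
  cons-≗ e (suc i) = e i
... | yes (x , f , p) = yes (x ∷ f , p)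
... | no none = no λ (f , pf) → none (f zero , (λ i → f (suc i)) , ext head∷tail pf)
  where
  head∷tail : ∀ {f : Fin (suc M) → _} → f ≗ (f zero ∷ (λ i → f (suc i)))
  head∷tail zero    = refl
  head∷tail (suc i) = refl

least-witness : ∀ {Q : ℕ → Set} → (∀ k → Dec (Q k)) → ∀ v → Q v → ∃ λ k → Q k × (∀ j → Q j → k ≤ j)
least-witness {Q} Q? = <-rec (λ v → Q v → ∃ λ k → Q k × (∀ j → Q j → k ≤ j)) step
  where
  step : ∀ v → (∀ {j} → j < v → Q j → ∃ λ k → Q k × (∀ j → Q j → k ≤ j)) → Q v →
    ∃ λ k → Q k × (∀ j → Q j → k ≤ j)
  step v smaller qv with anyUpTo? Q? v
  ... | yes (j , j<v , qj) = smaller j<v qj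
  ... | no none = v , qv , λ j qj → ≮⇒≥ λ j<v → none (j , j<v , qj)

minimum-exists : ∀ {M n} (P : (Fin M → Fin n) → Set) (val : (Fin M → Fin n) → ℕ) →
  (∀ f → Dec (P f)) → Extensional P → (∀ {f f'} → f ≗ f' → val f ≡ val f') →
  ∃ P → Σ ℕ (IsMinOver P val)
minimum-exists P val P? P-ext val-ext (f₀ , p₀)
  with least-witness attained? (val f₀) (f₀ , p₀ , refl)
  where
  attained? : ∀ k → Dec (∃ λ f → P f × val f ≡ k)
  attained? k = ∃-map? (λ f → P f × val f ≡ k) (λ f → P? f ×-dec (val f ≟ℕ k))
    (λ e (pf , vf) → P-ext e pf , trans (sym (val-ext e)) vf)
... | k , attained , least = k , attained , λ f pf → least (val f) (f , pf , refl)

module Decidability {m n : ℕ} (G : SimpleGraph m) where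

  isHom? : ∀ f → Dec (IsHom G n f)
  isHom? f = all? λ u → all? λ v → (adj G u v ≟𝔹 true) →-dec ¬? (f u ≟ f v)

  isEven? : ∀ (f : Fin m → Fin n) → Dec (IsEven G f)
  isEven? f = all? λ x → all? λ y → isOddEdge G f x y ≟𝔹 false

  isHom-ext : Extensional (IsHom G n)
  isHom-ext e hom u v a same = hom u v a (trans (e u) (trans same (sym (e v))))

  isEven-ext : Extensional (IsEven {n = n} G)
  isEven-ext {f} {f'} e even x y =
    trans (cong (λ c → not (x == y) ∧ (c % 2 ≡ᵇ 1)) (edgeCount-≗ G (λ u → sym (e u)) x y)) (even x y)

  defect-ext : ∀ {f f' : Fin m → Fin n} → f ≗ f' → defect G f ≡ defect G f'
  defect-ext e = cong (m ∸_) (countF-cong λ X → anyF-cong λ u → cong (_== X) (e u))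

module Square {m n : ℕ} (G : SimpleGraph m) (m+m≤n : m + m ≤ n) where

  open DisjointUnion {n = n} G G
  open Decidability {n = n} (square G)

  EvenHom : (Fin (m + m) → Fin n) → Set
  EvenHom f = IsHom (square G) n f × IsEven (square G) f

  -- Every homomorphism of G² is beaten by an even one: apply (2) to the
  -- better restriction and use (1).
  improve : ∀ f → IsHom (square G) n f → ∃ λ g → EvenHom g × 2 * defect (square G) g ≤ twiceR (square G) f
  improve f hom with ≤-total (twiceR G (take m f)) (twiceR G (drop m f))
  ... | inj₁ left≤right =
    let (g , even-hom , g≤) = evenDoubling G m+m≤n (take m f) (hom-take hom) in
    g , even-hom , ≤-trans (*-monoʳ-≤ 2 g≤) (≤-trans (twice-min left≤right) (twiceR-⊕ f))
  ... | inj₂ right≤left =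
    let (g , even-hom , g≤) = evenDoubling G m+m≤n (drop m f) (hom-drop hom) in
    g , even-hom , ≤-trans (*-monoʳ-≤ 2 g≤)
      (≤-trans (twice-min right≤left)
        (≤-trans (≤-reflexive (+-comm (twiceR G (drop m f)) (twiceR G (take m f)))) (twiceR-⊕ f)))

  embedding-hom : IsHom (square G) n (λ u → inject≤ u m+m≤n)
  embedding-hom u v a same with inject≤-injective m+m≤n m+m≤n u v same
  ... | refl with trans (sym a) (loopless (square G) u)
  ...   | ()

  twiceP : Σ ℕ (IsTwiceP (square G) n)
  twiceP =
    let (g , even-hom , _) = improve _ embedding-hom in
    minimum-exists EvenHom (λ f → 2 * defect (square G) f)
      (λ f → isHom? f ×-dec isEven? f)
      (λ e (hom , even) → isHom-ext e hom , isEven-ext e even)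
      (λ e → cong (2 *_) (defect-ext e))
      (g , even-hom)

double≤ : ∀ {m n} → 2 * m ≤ n → m + m ≤ n
double≤ {m} {n} = subst (λ z → m + z ≤ n) (+-identityʳ m)

-- 2p(G²) is attained by an even homomorphism g; since g has no odd vertices
-- it also attains 2r(g) = 2p(G²), and every homomorphism f has
-- 2r(f) ≥ 2p(G²) by improvement.
mainTheorem18 : ∀ {m} (G : SimpleGraph m) (n : ℕ) → 2 * m ≤ n →
    Σ ℕ (λ k → IsTwiceP (square G) n k × IsTwiceRbar (square G) n k)
mainTheorem18 {m} G n 2m≤n with Square.twiceP G (double≤ {m} {n} 2m≤n)
... | k , isP@((g , (hom , even) , 2defect≡k) , least) =
  k , isP , (g , hom , trans (even⇒twiceR (square G) g even) 2defect≡k) , bound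
  where
  bound : ∀ f → IsHom (square G) n f → k ≤ twiceR (square G) f
  bound f hom-f with Square.improve G (double≤ {m} {n} 2m≤n) f hom-f
  ... | g' , even-hom' , g'≤f = ≤-trans (least g' even-hom') g'≤f
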